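{- Let $k,d$ be positive integers, let $c_1,c_2\in[0,1]$ be such that $c_1d<k$, and let $c_3:=\frac{c_1(1-c_2)}{2}$. Let $G$ be a graph on more than $k$ vertices, with maximum degree $d$, such that $i_k(G)\ge c_1d$. Then there exists a subgraph $G'\subseteq G$ with $|V(G')|\ge|V(G)|-k$ such that $i_{[c_3k]}(G')\ge c_1c_2d$.
   Context: For $S\subseteq V(H)$, $\partial_H(S)$ is the number of edges of $H$ with exactly one endpoint in $S$. For an $n$-vertex graph $H$ and $I\subseteq[n]$, $i_I(H)=\min\{\partial_H(S)/|S| : S\subseteq V(H),\ |S|\in I\}$; $i_k(H)=i_{\{k\}}(H)$ (sets of size exactly $k$), and $i_{[m]}(H)$ is the minimum over all nonempty $S$ with $|S|\le m$.
   Formalization: The constants $c_1,c_2$ are rational numbers in [0,1] rather than arbitrary reals in that interval. -}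

module Defs where

open import Data.Nat using (ℕ; zero; suc; NonZero)
open import Data.Bool using (Bool; true; false; if_then_else_)
open import Data.Fin using (Fin)
open import Data.Fin.Subset using (Subset; ∣_∣; _∈_)
open import Data.Fin.Subset.Properties using (_∈?_)
open import Data.Vec using (Vec; lookup)
open import Data.List using (List; map)
open import Data.Nat.ListAction using (sum)
open import Data.List using () renaming (allFin to allFinL)
open import Data.Product using (Σ; _×_; ∃)
open import Relation.Nullary using (Dec; yes; no; ¬_)
open import Relation.Binary.PropositionalEquality using (_≡_)
open import Data.Integer using (+_)
open import Data.Rational using (ℚ; _/_; _≤_)

record Graph (n : ℕ) : Set where
  field
    adj    : Fin n → Fin n → Bool
    sym    : ∀ u v → adj u v ≡ adj v u
    irrefl : ∀ v → adj v v ≡ false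
open Graph public

Σv : {n : ℕ} → (Fin n → ℕ) → ℕ
Σv {n} f = sum (map f (allFinL n))

b2n : Bool → ℕ
b2n true  = 1
b2n false = 0

deg : {n : ℕ} → Graph n → Fin n → ℕ
deg G v = Σv (λ u → b2n (adj G v u))

MaxDegree : {n : ℕ} → Graph n → ℕ → Set
MaxDegree {n} G d = (∀ v → deg G v Data.Nat.≤ d) × (∃ λ v → deg G v ≡ d)

-- ∂_G(S): number of edges with exactly one endpoint in S.  Each such edge
-- {u,v} with u ∈ S, v ∉ S is counted once, as the ordered pair (u , v).
boundary : {n : ℕ} → Graph n → Subset n → ℕ
boundary G S =
  Σv (λ u → Σv (λ v → inS u (inS v 0 (b2n (adj G u v))) 0))
  where
  inS : ∀ {A : Set} → _ → A → A → A
  inS x a b with x ∈? S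
  ... | yes _ = a
  ... | no  _ = b

ratio : {n : ℕ} → Graph n → (S : Subset n) → .{{NonZero ∣ S ∣}} → ℚ
ratio G S = (+ boundary G S) / ∣ S ∣

-- "i_I(G) ≥ r" where I is given by the predicate P on sizes:
-- the minimum of ∂(S)/|S| over all S with |S| ∈ I is at least r
-- (vacuous if there is no such S, i.e. min over ∅ = +∞).
-- Sizes in I are required to be positive (I ⊆ [n]).
iAtLeast : {n : ℕ} → Graph n → (ℕ → Set) → ℚ → Set
iAtLeast {n} G P r =
  ∀ (S : Subset n) → P ∣ S ∣ → .{{_ : NonZero ∣ S ∣}} → r ≤ ratio G S

-- G' is (isomorphic to) a subgraph of G: an injective vertex map
-- sending edges to edges.
IsSubgraph : {m n : ℕ} → Graph m → Graph n → Set
IsSubgraph {m} {n} G' G =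
  Σ (Fin m → Fin n) λ f →
    (∀ x y → f x ≡ f y → x ≡ y) ×
    (∀ x y → adj G' x y ≡ true → adj G (f x) (f y) ≡ true)

-- Take U of maximum size among the vertex sets with ∂U ≤ c₁c₂d|U| and |U| + c₃k < k (the empty
-- set is one), and let G′ = G − U. Were there S in G′ with 1 ≤ |S| ≤ c₃k and ∂_{G′}S < c₁c₂d|S|,
-- then X = U ∪ S would satisfy ∂X ≤ ∂U + ∂_{G′}S < c₁c₂d|X| and |X| < k, so by maximality of U
-- we would have k ≤ |X| + c₃k. Padding X with k − |X| further vertices gives a k-set W with
-- c₁dk ≤ ∂W ≤ ∂X + (k − |X|)d < c₁c₂dk + c₃dk, i.e. c₁(1 − c₂)dk < c₃dk = c₁(1 − c₂)dk/2,
-- which is impossible.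
module Submission where

open import Defs hiding (sym)

module _ where
  open import Data.Nat
  open import Data.Nat.Properties hiding (suc-injective)
  open import Data.Bool using (true; false; not; _∧_; _∨_)
  open import Data.Fin using (Fin; zero; suc)
  open import Data.Fin.Properties using (suc-injective)
  open import Data.Fin.Subset using (Subset; ∣_∣; _∉_; _⊆_; _∪_; ∁; ⊥)
  open import Data.Fin.Subset.Properties
    using (_∈?_; ∣⊥∣≡0; ∣p∣≤n; ∣∁p∣≡n∸∣p∣; ⊆-refl; p⊆p∪q; p⊆q⇒∁p⊇∁q; anySubset?)
  open import Data.Vec using ([]; _∷_; lookup)
  open import Data.Vec.Properties using (lookup-map; lookup-zipWith; []=⇒lookup; lookup⇒[]=)
  import Data.List as List using (tabulate)
  import Data.List.Properties as List using (map-tabulate)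
  import Data.Nat.ListAction as List
  open import Data.Product using (Σ; _×_; _,_; proj₁; proj₂)
  open import Data.Empty using (⊥-elim)
  open import Function using (_∘_; Injective)
  open import Relation.Nullary using (yes; no)
  open import Relation.Nullary.Decidable using (_×-dec_)
  open import Relation.Unary using (Decidable)
  open import Relation.Binary.PropositionalEquality
  open import Algebra.Properties.CommutativeMonoid.Sum +-0-commutativeMonoid
    using (sum; sum-syntax; ∑-distrib-+; sum-cong-≗; sum-replicate-zero)
  open import Algebra.Properties.Semiring.Sum +-*-semiring using (*-distribʳ-sum)

  sum-mono-≤ : ∀ {n} {f g : Fin n → ℕ} → (∀ i → f i ≤ g i) → sum f ≤ sum g
  sum-mono-≤ {zero}  f≤g = z≤n
  sum-mono-≤ {suc n} f≤g = +-mono-≤ (f≤g zero) (sum-mono-≤ (f≤g ∘ suc))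

  sum-tabulate : ∀ {n} (f : Fin n → ℕ) → List.sum (List.tabulate f) ≡ sum f
  sum-tabulate {zero}  f = refl
  sum-tabulate {suc n} f = cong (f zero +_) (sum-tabulate (f ∘ suc))

  Σv≡∑ : ∀ {n} (f : Fin n → ℕ) → Σv f ≡ sum f
  Σv≡∑ f = trans (cong List.sum (List.map-tabulate (λ i → i) f)) (sum-tabulate f)

  ∣p∣≡∑ : ∀ {n} (p : Subset n) → ∣ p ∣ ≡ ∑[ v < n ] b2n (lookup p v)
  ∣p∣≡∑ []          = refl
  ∣p∣≡∑ (true ∷ p)  = cong suc (∣p∣≡∑ p)
  ∣p∣≡∑ (false ∷ p) = ∣p∣≡∑ p

  lookup-∉ : ∀ {n} {x : Fin n} {p : Subset n} → x ∉ p → lookup p x ≡ false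
  lookup-∉ {x = x} {p} x∉p with lookup p x in eq
  ... | true  = ⊥-elim (x∉p (lookup⇒[]= x p eq))
  ... | false = refl

  lookup-⊆ : ∀ {n} {p q : Subset n} {x : Fin n} → p ⊆ q → lookup p x ≡ true → lookup q x ≡ true
  lookup-⊆ {p = p} {x = x} p⊆q eq = []=⇒lookup (p⊆q (lookup⇒[]= x p eq))

  b2n-∧-mono : ∀ {a a′ b b′} x → (a ≡ true → a′ ≡ true) → (b ≡ true → b′ ≡ true) →
               b2n (a ∧ b ∧ x) ≤ b2n (a′ ∧ b′ ∧ x)
  b2n-∧-mono {false} x _ _ = z≤n
  b2n-∧-mono {true} {b = false} x _ _ = z≤n
  b2n-∧-mono {true} {false} {true} x a⇒a′ _ with () ← a⇒a′ refl
  b2n-∧-mono {true} {true} {true} {false} x _ b⇒b′ with () ← b⇒b′ refl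
  b2n-∧-mono {true} {true} {true} {true} x _ _ = ≤-refl

  b2n-∨-∧ : ∀ a a′ x → b2n ((a ∨ a′) ∧ x) ≤ b2n (a ∧ x) + b2n (a′ ∧ x)
  b2n-∨-∧ true  a′ x = m≤m+n _ _
  b2n-∨-∧ false a′ x = ≤-refl

  edges : ∀ {n} → Graph n → Subset n → Subset n → ℕ
  edges {n} G A B = ∑[ u < n ] ∑[ v < n ] b2n (lookup A u ∧ lookup B v ∧ adj G u v)

  -- The summand of boundary is local to its where block; this exposes it.
  boundary-summand : ∀ {n} (G : Graph n) (S : Subset n) →
                     Σ (Fin n → Fin n → ℕ) λ F → boundary G S ≡ Σv (λ u → Σv (F u))
  boundary-summand G S = _ , refl

  boundary≡edges : ∀ {n} (G : Graph n) (S : Subset n) → boundary G S ≡ edges G S (∁ S)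
  boundary≡edges {n} G S = begin
      boundary G S                    ≡⟨ proj₂ (boundary-summand G S) ⟩
      Σv (λ u → Σv (F u))             ≡⟨ Σv≡∑ (λ u → Σv (F u)) ⟩
      ∑[ u < n ] Σv (F u)             ≡⟨ sum-cong-≗ (λ u → trans (Σv≡∑ (F u)) (sum-cong-≗ (summand u))) ⟩
      edges G S (∁ S)                 ∎
    where
    open ≡-Reasoning
    F : Fin n → Fin n → ℕ
    F = proj₁ (boundary-summand G S)
    summand : ∀ u v → F u v ≡ b2n (lookup S u ∧ lookup (∁ S) v ∧ adj G u v)
    summand u v rewrite lookup-map v not S with u ∈? S
    ... | no u∉S rewrite lookup-∉ u∉S = refl
    ... | yes u∈S with v ∈? S
    ...   | yes v∈S rewrite []=⇒lookup u∈S | []=⇒lookup v∈S = refl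
    ...   | no v∉S rewrite []=⇒lookup u∈S | lookup-∉ v∉S = refl

  edges-mono : ∀ {n} (G : Graph n) {A A′ B B′ : Subset n} → A ⊆ A′ → B ⊆ B′ → edges G A B ≤ edges G A′ B′
  edges-mono G A⊆A′ B⊆B′ =
    sum-mono-≤ (λ u → sum-mono-≤ (λ v → b2n-∧-mono (adj G u v) (lookup-⊆ A⊆A′) (lookup-⊆ B⊆B′)))

  edges-∪ˡ : ∀ {n} (G : Graph n) (A A′ B : Subset n) → edges G (A ∪ A′) B ≤ edges G A B + edges G A′ B
  edges-∪ˡ {n} G A A′ B = begin
      edges G (A ∪ A′) B                 ≤⟨ sum-mono-≤ (λ u → sum-mono-≤ (summand u)) ⟩
      ∑[ u < n ] ∑[ v < n ] (e A u v + e A′ u v)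
        ≡⟨ sum-cong-≗ (λ u → ∑-distrib-+ (e A u) (e A′ u)) ⟩
      ∑[ u < n ] (∑[ v < n ] e A u v + ∑[ v < n ] e A′ u v)
        ≡⟨ ∑-distrib-+ (λ u → ∑[ v < n ] e A u v) (λ u → ∑[ v < n ] e A′ u v) ⟩
      edges G A B + edges G A′ B         ∎
    where
    open ≤-Reasoning
    e : Subset n → Fin n → Fin n → ℕ
    e X u v = b2n (lookup X u ∧ lookup B v ∧ adj G u v)
    summand : ∀ u v → e (A ∪ A′) u v ≤ e A u v + e A′ u v
    summand u v rewrite lookup-zipWith _∨_ u A A′ = b2n-∨-∧ (lookup A u) (lookup A′ u) _

  edges≤∣∣*Δ : ∀ {n} (G : Graph n) {Δ} → (∀ v → deg G v ≤ Δ) → (A B : Subset n) → edges G A B ≤ ∣ A ∣ * Δ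
  edges≤∣∣*Δ {n} G {Δ} deg≤Δ A B = begin
      edges G A B                            ≤⟨ sum-mono-≤ row ⟩
      ∑[ u < n ] (b2n (lookup A u) * Δ)      ≡⟨ *-distribʳ-sum Δ (λ u → b2n (lookup A u)) ⟨
      (∑[ u < n ] b2n (lookup A u)) * Δ      ≡⟨ cong (_* Δ) (∣p∣≡∑ A) ⟨
      ∣ A ∣ * Δ                              ∎
    where
    open ≤-Reasoning
    row : ∀ u → ∑[ v < n ] b2n (lookup A u ∧ lookup B v ∧ adj G u v) ≤ b2n (lookup A u) * Δ
    row u with lookup A u
    ... | false = ≤-reflexive (sum-replicate-zero n)
    ... | true  = begin
      ∑[ v < n ] b2n (lookup B v ∧ adj G u v)
        ≤⟨ sum-mono-≤ (λ v → b2n-∧-mono (adj G u v) (λ e → e) (λ _ → refl)) ⟩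
      ∑[ v < n ] b2n (adj G u v)               ≡⟨ Σv≡∑ (λ v → b2n (adj G u v)) ⟨
      deg G u                                  ≤⟨ deg≤Δ u ⟩
      Δ                                        ≡⟨ +-identityʳ Δ ⟨
      1 * Δ                                    ∎

  boundary≤∣∣*Δ : ∀ {n} (G : Graph n) {Δ} → (∀ v → deg G v ≤ Δ) → (S : Subset n) → boundary G S ≤ ∣ S ∣ * Δ
  boundary≤∣∣*Δ G deg≤Δ S = ≤-trans (≤-reflexive (boundary≡edges G S)) (edges≤∣∣*Δ G deg≤Δ S (∁ S))

  boundary-∪ : ∀ {n} (G : Graph n) (A B : Subset n) → boundary G (A ∪ B) ≤ boundary G A + edges G B (∁ (A ∪ B))
  boundary-∪ G A B = begin
      boundary G (A ∪ B)                                 ≡⟨ boundary≡edges G (A ∪ B) ⟩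
      edges G (A ∪ B) (∁ (A ∪ B))                        ≤⟨ edges-∪ˡ G A B (∁ (A ∪ B)) ⟩
      edges G A (∁ (A ∪ B)) + edges G B (∁ (A ∪ B))
        ≤⟨ +-monoˡ-≤ (edges G B (∁ (A ∪ B))) (edges-mono G {A} ⊆-refl (p⊆q⇒∁p⊇∁q (p⊆p∪q {p = A} B))) ⟩
      edges G A (∁ A) + edges G B (∁ (A ∪ B))            ≡⟨ cong (_+ edges G B (∁ (A ∪ B))) (boundary≡edges G A) ⟨
      boundary G A + edges G B (∁ (A ∪ B))               ∎
    where open ≤-Reasoning

  embed : ∀ {n} (C : Subset n) → Fin ∣ C ∣ → Fin n
  embed (true ∷ C)  zero    = zero
  embed (true ∷ C)  (suc i) = suc (embed C i)
  embed (false ∷ C) i       = suc (embed C i)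

  embed-injective : ∀ {n} (C : Subset n) → Injective _≡_ _≡_ (embed C)
  embed-injective (true ∷ C)  {zero}  {zero}  _  = refl
  embed-injective (true ∷ C)  {suc i} {suc j} eq = cong suc (embed-injective C (suc-injective eq))
  embed-injective (false ∷ C) eq = embed-injective C (suc-injective eq)

  induced : ∀ {n} → Graph n → (C : Subset n) → Graph ∣ C ∣
  induced G C = record
    { adj    = λ i j → adj G (embed C i) (embed C j)
    ; sym    = λ i j → Graph.sym G (embed C i) (embed C j)
    ; irrefl = λ i → irrefl G (embed C i)
    }

  image : ∀ {n} (C : Subset n) → Subset ∣ C ∣ → Subset n
  image []          []      = []
  image (true ∷ C)  (b ∷ s) = b ∷ image C s
  image (false ∷ C) s       = false ∷ image C s

  lookup-image : ∀ {n} (C : Subset n) (s : Subset ∣ C ∣) i → lookup (image C s) (embed C i) ≡ lookup s i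
  lookup-image (true ∷ C)  (b ∷ s) zero    = refl
  lookup-image (true ∷ C)  (b ∷ s) (suc i) = lookup-image C s i
  lookup-image (false ∷ C) s       i       = lookup-image C s i

  lookup-image-outside : ∀ {n} (C : Subset n) (s : Subset ∣ C ∣) {v} →
                         lookup C v ≡ false → lookup (image C s) v ≡ false
  lookup-image-outside (true ∷ C)  (b ∷ s) {suc v} v∉C = lookup-image-outside C s v∉C
  lookup-image-outside (false ∷ C) s       {zero}  _   = refl
  lookup-image-outside (false ∷ C) s       {suc v} v∉C = lookup-image-outside C s v∉C

  ∣image∣ : ∀ {n} (C : Subset n) (s : Subset ∣ C ∣) → ∣ image C s ∣ ≡ ∣ s ∣
  ∣image∣ []          []          = refl
  ∣image∣ (true ∷ C)  (true ∷ s)  = cong suc (∣image∣ C s)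
  ∣image∣ (true ∷ C)  (false ∷ s) = ∣image∣ C s
  ∣image∣ (false ∷ C) s           = ∣image∣ C s

  ∣∪-image-∁∣ : ∀ {n} (U : Subset n) (s : Subset ∣ ∁ U ∣) → ∣ U ∪ image (∁ U) s ∣ ≡ ∣ U ∣ + ∣ s ∣
  ∣∪-image-∁∣ []          []          = refl
  ∣∪-image-∁∣ (true ∷ U)  s           = cong suc (∣∪-image-∁∣ U s)
  ∣∪-image-∁∣ (false ∷ U) (true ∷ s)  = trans (cong suc (∣∪-image-∁∣ U s)) (sym (+-suc ∣ U ∣ ∣ s ∣))
  ∣∪-image-∁∣ (false ∷ U) (false ∷ s) = ∣∪-image-∁∣ U s

  ∁-∪-image-∁ : ∀ {n} (U : Subset n) (s : Subset ∣ ∁ U ∣) → ∁ (U ∪ image (∁ U) s) ≡ image (∁ U) (∁ s)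
  ∁-∪-image-∁ []          []      = refl
  ∁-∪-image-∁ (true ∷ U)  s       = cong (false ∷_) (∁-∪-image-∁ U s)
  ∁-∪-image-∁ (false ∷ U) (b ∷ s) = cong (not b ∷_) (∁-∪-image-∁ U s)

  sum-embed : ∀ {n} (C : Subset n) (f : Fin n → ℕ) → (∀ v → lookup C v ≡ false → f v ≡ 0) →
              ∑[ i < ∣ C ∣ ] f (embed C i) ≡ ∑[ v < n ] f v
  sum-embed []          f _    = refl
  sum-embed (true ∷ C)  f f≡0 = cong (f zero +_) (sum-embed C (f ∘ suc) (f≡0 ∘ suc))
  sum-embed (false ∷ C) f f≡0 = cong₂ _+_ (sym (f≡0 zero refl)) (sum-embed C (f ∘ suc) (f≡0 ∘ suc))

  edges-induced : ∀ {n} (G : Graph n) (C : Subset n) (s t : Subset ∣ C ∣) →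
                  edges (induced G C) s t ≡ edges G (image C s) (image C t)
  edges-induced {n} G C s t = begin
      edges (induced G C) s t
        ≡⟨ sum-cong-≗ (λ i → sum-cong-≗ (λ j → cong₂ (λ a b → b2n (a ∧ b ∧ adj G (embed C i) (embed C j)))
             (sym (lookup-image C s i)) (sym (lookup-image C t j)))) ⟩
      ∑[ i < ∣ C ∣ ] ∑[ j < ∣ C ∣ ] e (embed C i) (embed C j)
        ≡⟨ sum-cong-≗ (λ i → sum-embed C (e (embed C i)) (e-outsideʳ (embed C i))) ⟩
      ∑[ i < ∣ C ∣ ] ∑[ v < n ] e (embed C i) v
        ≡⟨ sum-embed C (λ u → ∑[ v < n ] e u v) e-outsideˡ ⟩
      edges G (image C s) (image C t)
        ∎
    where
    open ≡-Reasoning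
    e : Fin n → Fin n → ℕ
    e u v = b2n (lookup (image C s) u ∧ lookup (image C t) v ∧ adj G u v)
    e-outsideʳ : ∀ u v → lookup C v ≡ false → e u v ≡ 0
    e-outsideʳ u v v∉C rewrite lookup-image-outside C t v∉C with lookup (image C s) u
    ... | true  = refl
    ... | false = refl
    e-outsideˡ : ∀ u → lookup C u ≡ false → ∑[ v < n ] e u v ≡ 0
    e-outsideˡ u u∉C rewrite lookup-image-outside C s u∉C = sum-replicate-zero n

  boundary-∪-image-∁ : ∀ {n} (G : Graph n) (U : Subset n) (s : Subset ∣ ∁ U ∣) →
    boundary G (U ∪ image (∁ U) s) ≤ boundary G U + boundary (induced G (∁ U)) s
  boundary-∪-image-∁ {n} G U s = begin
      boundary G (U ∪ T)
        ≤⟨ boundary-∪ G U T ⟩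
      boundary G U + edges G T (∁ (U ∪ T))
        ≡⟨ cong (λ B → boundary G U + edges G T B) (∁-∪-image-∁ U s) ⟩
      boundary G U + edges G T (image (∁ U) (∁ s))
        ≡⟨ cong (boundary G U +_) (edges-induced G (∁ U) s (∁ s)) ⟨
      boundary G U + edges (induced G (∁ U)) s (∁ s)
        ≡⟨ cong (boundary G U +_) (boundary≡edges (induced G (∁ U)) s) ⟨
      boundary G U + boundary (induced G (∁ U)) s
        ∎
    where
    open ≤-Reasoning
    T : Subset n
    T = image (∁ U) s

  subset-of-size : ∀ {m} j → j ≤ m → Σ (Subset m) λ s → ∣ s ∣ ≡ j
  subset-of-size {m}     zero    _         = ⊥ , ∣⊥∣≡0 m
  subset-of-size {suc m} (suc j) (s≤s j≤m) with subset-of-size j j≤m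
  ... | s , ∣s∣≡j = true ∷ s , cong suc ∣s∣≡j

  pad : ∀ {n} (G : Graph n) {Δ} → (∀ v → deg G v ≤ Δ) → (X : Subset n) {k : ℕ} → ∣ X ∣ ≤ k → k ≤ n →
        Σ (Subset n) λ W → ∣ W ∣ ≡ k × boundary G W ≤ boundary G X + (k ∸ ∣ X ∣) * Δ
  pad {n} G {Δ} deg≤Δ X {k} ∣X∣≤k k≤n = X ∪ T , ∣W∣≡k , ∂W≤
    where
    room : k ∸ ∣ X ∣ ≤ ∣ ∁ X ∣
    room = subst (k ∸ ∣ X ∣ ≤_) (sym (∣∁p∣≡n∸∣p∣ X)) (∸-monoˡ-≤ ∣ X ∣ k≤n)
    s : Subset ∣ ∁ X ∣
    s = proj₁ (subset-of-size (k ∸ ∣ X ∣) room)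
    ∣s∣ : ∣ s ∣ ≡ k ∸ ∣ X ∣
    ∣s∣ = proj₂ (subset-of-size (k ∸ ∣ X ∣) room)
    T : Subset n
    T = image (∁ X) s
    ∣W∣≡k : ∣ X ∪ T ∣ ≡ k
    ∣W∣≡k = trans (∣∪-image-∁∣ X s) (trans (cong (∣ X ∣ +_) ∣s∣) (m+[n∸m]≡n ∣X∣≤k))
    ∂W≤ : boundary G (X ∪ T) ≤ boundary G X + (k ∸ ∣ X ∣) * Δ
    ∂W≤ = begin
      boundary G (X ∪ T)                     ≤⟨ boundary-∪ G X T ⟩
      boundary G X + edges G T (∁ (X ∪ T))   ≤⟨ +-monoʳ-≤ (boundary G X) (edges≤∣∣*Δ G deg≤Δ T (∁ (X ∪ T))) ⟩
      boundary G X + ∣ T ∣ * Δ               ≡⟨ cong (λ t → boundary G X + t * Δ) (trans (∣image∣ (∁ X) s) ∣s∣) ⟩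
      boundary G X + (k ∸ ∣ X ∣) * Δ         ∎
      where open ≤-Reasoning

  largestSubset : ∀ {n} {P : Subset n → Set} → Decidable P → ∀ {V₀} → P V₀ →
                  Σ (Subset n) λ U → P U × (∀ V → P V → ∣ V ∣ ≤ ∣ U ∣)
  largestSubset {n} {P} P? {V₀} pV₀ = search n (λ V _ → ∣p∣≤n V)
    where
    search : ∀ s → (∀ V → P V → ∣ V ∣ ≤ s) → Σ (Subset n) λ U → P U × (∀ V → P V → ∣ V ∣ ≤ ∣ U ∣)
    search s bound with anySubset? (λ V → P? V ×-dec (∣ V ∣ ≟ s))
    ... | yes (U , pU , ∣U∣≡s) = U , pU , λ V pV → subst (∣ V ∣ ≤_) (sym ∣U∣≡s) (bound V pV)
    search zero    bound | no none = ⊥-elim (none (V₀ , pV₀ , n≤0⇒n≡0 (bound V₀ pV₀)))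
    search (suc s) bound | no none =
      search s (λ V pV → m<1+n⇒m≤n (≤∧≢⇒< (bound V pV) (λ ∣V∣≡s → none (V , pV , ∣V∣≡s))))

module _ where
  open import Data.Nat as ℕ using (ℕ; suc; z≤n)
  import Data.Nat.Properties as ℕ
  import Data.Nat.Coprimality as Coprimality
  open import Data.Integer as ℤ using (+_)
  import Data.Integer.Properties as ℤ
  open import Data.Rational
  open import Data.Rational.Properties
  import Data.Rational.Unnormalised as ℚᵘ
  import Data.Rational.Unnormalised.Properties as ℚᵘ
  open import Data.Rational.Solver using (module +-*-Solver)
  open import Data.Empty using (⊥)
  open import Relation.Binary.PropositionalEquality

  fromℕ : ℕ → ℚ
  fromℕ a = + a / 1

  fromℕ≡mkℚ : ∀ a → fromℕ a ≡ mkℚ (+ a) 0 (Coprimality.sym (Coprimality.1-coprimeTo a))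
  fromℕ≡mkℚ a = normalize-coprime (Coprimality.sym (Coprimality.1-coprimeTo a))

  fromℕ-+ : ∀ a b → fromℕ (a ℕ.+ b) ≡ fromℕ a + fromℕ b
  fromℕ-+ a b rewrite fromℕ≡mkℚ a | fromℕ≡mkℚ b =
    cong (_/ 1) (trans (ℤ.pos-+ a b) (sym (cong₂ ℤ._+_ (ℤ.*-identityʳ (+ a)) (ℤ.*-identityʳ (+ b)))))

  fromℕ-* : ∀ a b → fromℕ (a ℕ.* b) ≡ fromℕ a * fromℕ b
  fromℕ-* a b rewrite fromℕ≡mkℚ a | fromℕ≡mkℚ b = cong (_/ 1) (ℤ.pos-* a b)

  fromℕ-mono-≤ : ∀ {a b} → a ℕ.≤ b → fromℕ a ≤ fromℕ b
  fromℕ-mono-≤ {a} {b} a≤b rewrite fromℕ≡mkℚ a | fromℕ≡mkℚ b =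
    *≤* (subst₂ ℤ._≤_ (sym (ℤ.*-identityʳ (+ a))) (sym (ℤ.*-identityʳ (+ b))) (ℤ.+≤+ a≤b))

  fromℕ-mono-< : ∀ {a b} → a ℕ.< b → fromℕ a < fromℕ b
  fromℕ-mono-< {a} {b} a<b rewrite fromℕ≡mkℚ a | fromℕ≡mkℚ b =
    *<* (subst₂ ℤ._<_ (sym (ℤ.*-identityʳ (+ a))) (sym (ℤ.*-identityʳ (+ b))) (ℤ.+<+ a<b))

  fromℕ-cancel-< : ∀ {a b} → fromℕ a < fromℕ b → a ℕ.< b
  fromℕ-cancel-< a<b = ℕ.≰⇒> (λ b≤a → <-irrefl refl (<-≤-trans a<b (fromℕ-mono-≤ b≤a)))

  fromℕ-nonNeg : ∀ a → 0ℚ ≤ fromℕ a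
  fromℕ-nonNeg a = fromℕ-mono-≤ {0} {a} z≤n

  m/n*n≡m : ∀ m n .{{_ : ℕ.NonZero n}} → (+ m / n) * fromℕ n ≡ fromℕ m
  m/n*n≡m m (suc n) = toℚᵘ-injective (begin
      toℚᵘ (+ m / suc n * fromℕ (suc n))
        ≈⟨ toℚᵘ-homo-* (+ m / suc n) (fromℕ (suc n)) ⟩
      toℚᵘ (+ m / suc n) ℚᵘ.* toℚᵘ (fromℕ (suc n))
        ≈⟨ ℚᵘ.*-cong (toℚᵘ-fromℚᵘ (ℚᵘ.mkℚᵘ (+ m) n)) (toℚᵘ-fromℚᵘ (ℚᵘ.mkℚᵘ (+ suc n) 0)) ⟩
      ℚᵘ.mkℚᵘ (+ m) n ℚᵘ.* ℚᵘ.mkℚᵘ (+ suc n) 0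
        ≈⟨ ℚᵘ.*≡* (trans (ℤ.*-identityʳ _) (cong (λ z → + m ℤ.* + z) (sym (ℕ.*-identityʳ (suc n))))) ⟩
      ℚᵘ.mkℚᵘ (+ m) 0
        ≈⟨ toℚᵘ-fromℚᵘ (ℚᵘ.mkℚᵘ (+ m) 0) ⟨
      toℚᵘ (fromℕ m)
        ∎)
    where open ℚᵘ.≃-Reasoning

  p≤m/n⇒p*n≤m : ∀ {p} m n .{{_ : ℕ.NonZero n}} → p ≤ + m / n → p * fromℕ n ≤ fromℕ m
  p≤m/n⇒p*n≤m {p} m n p≤m/n =
    subst (p * fromℕ n ≤_) (m/n*n≡m m n) (*-monoʳ-≤-nonNeg (fromℕ n) {{nonNegative (fromℕ-nonNeg n)}} p≤m/n)

  m/n<p⇒m<p*n : ∀ {p} m n .{{_ : ℕ.NonZero n}} → + m / n < p → fromℕ m < p * fromℕ n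
  m/n<p⇒m<p*n {p} m n@(suc _) m/n<p =
    subst (_< p * fromℕ n) (m/n*n≡m m n)
      (*-monoˡ-<-pos (fromℕ n) {{positive (fromℕ-mono-< {0} {n} (ℕ.s≤s z≤n))}} m/n<p)

  p≤q⇒0≤q-p : ∀ {p q} → p ≤ q → 0ℚ ≤ q - p
  p≤q⇒0≤q-p {p} {q} p≤q = subst (_≤ q - p) (+-inverseʳ p) (+-monoˡ-≤ (- p) p≤q)

  0<q-p⇒p<q : ∀ {p q} → 0ℚ < q - p → p < q
  0<q-p⇒p<q {p} {q} 0<q-p =
    subst₂ _<_ (+-identityˡ p) (solve 2 (λ p q → (q :- p) :+ p := q) refl p q) (+-monoˡ-< p 0<q-p)
    where open +-*-Solver

  *-nonNeg : ∀ {p q} → 0ℚ ≤ p → 0ℚ ≤ q → 0ℚ ≤ p * q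
  *-nonNeg {p} {q} 0≤p 0≤q =
    nonNegative⁻¹ (p * q) {{nonNeg*nonNeg⇒nonNeg p {{nonNegative 0≤p}} q {{nonNegative 0≤q}}}}

  c₃K<K : ∀ c₁ c₂ K → 0ℚ ≤ c₁ → c₁ ≤ 1ℚ → 0ℚ ≤ c₂ → 0ℚ < K → c₁ * (1ℚ - c₂) * ½ * K < K
  c₃K<K c₁ c₂ K 0≤c₁ c₁≤1 0≤c₂ 0<K = 0<q-p⇒p<q (<-≤-trans 0<rhs (≤-reflexive (sym certificate)))
    where
    open +-*-Solver
    certificate : K - c₁ * (1ℚ - c₂) * ½ * K ≡ ½ * K * ((1ℚ - c₁) + c₁ * c₂) + ½ * K
    certificate = solve 3 (λ c₁ c₂ K → K :- c₁ :* (con 1ℚ :- c₂) :* con ½ :* K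
                                     := con ½ :* K :* ((con 1ℚ :- c₁) :+ c₁ :* c₂) :+ con ½ :* K) refl c₁ c₂ K
    0<½K : 0ℚ < ½ * K
    0<½K = subst (_< ½ * K) (*-zeroʳ ½) (*-monoʳ-<-pos ½ 0<K)
    0<rhs : 0ℚ < ½ * K * ((1ℚ - c₁) + c₁ * c₂) + ½ * K
    0<rhs = +-mono-≤-< (*-nonNeg (<⇒≤ 0<½K) (+-mono-≤ (p≤q⇒0≤q-p c₁≤1) (*-nonNeg 0≤c₁ 0≤c₂))) 0<½K

  -- The hypotheses, added with weights 1, 1, 2D together with 0 ≤ DY(1 + c₁c₂), give L < R for
  -- two identical polynomials L and R.
  padding-inequalities-inconsistent : ∀ c₁ c₂ D X Y B → 0ℚ ≤ c₁ → 0ℚ ≤ c₂ → 0ℚ ≤ D → 0ℚ ≤ Y →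
    B < c₁ * c₂ * D * X → c₁ * D * (X + Y) ≤ B + Y * D → X + Y ≤ X + c₁ * (1ℚ - c₂) * ½ * (X + Y) → ⊥
  padding-inequalities-inconsistent c₁ c₂ D X Y B 0≤c₁ 0≤c₂ 0≤D 0≤Y B<r*X c₁DK≤B+YD K≤X+c₃K =
    <-irrefl identity (+-mono-<-≤ (+-mono-<-≤ (+-mono-<-≤ B<r*X c₁DK≤B+YD) 2D*K≤2D*[X+c₃K]) 0≤DY[1+c₁c₂])
    where
    open +-*-Solver
    2D*K≤2D*[X+c₃K] : (D + D) * (X + Y) ≤ (D + D) * (X + c₁ * (1ℚ - c₂) * ½ * (X + Y))
    2D*K≤2D*[X+c₃K] = *-monoˡ-≤-nonNeg (D + D) {{nonNegative (+-mono-≤ 0≤D 0≤D)}} K≤X+c₃K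
    0≤DY[1+c₁c₂] : 0ℚ ≤ D * Y * (1ℚ + c₁ * c₂)
    0≤DY[1+c₁c₂] = *-nonNeg (*-nonNeg 0≤D 0≤Y) (+-mono-≤ (nonNegative⁻¹ 1ℚ) (*-nonNeg 0≤c₁ 0≤c₂))
    identity : B + c₁ * D * (X + Y) + (D + D) * (X + Y) + 0ℚ
             ≡ c₁ * c₂ * D * X + (B + Y * D) + (D + D) * (X + c₁ * (1ℚ - c₂) * ½ * (X + Y))
               + D * Y * (1ℚ + c₁ * c₂)
    identity = solve 6 (λ c₁ c₂ D X Y B →
        B :+ c₁ :* D :* (X :+ Y) :+ (D :+ D) :* (X :+ Y) :+ con 0ℚ
      := c₁ :* c₂ :* D :* X :+ (B :+ Y :* D) :+ (D :+ D) :* (X :+ c₁ :* (con 1ℚ :- c₂) :* con ½ :* (X :+ Y))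
         :+ D :* Y :* (con 1ℚ :+ c₁ :* c₂)) refl c₁ c₂ D X Y B

open import Data.Nat using (ℕ; _∸_; _≤_; _<_)
open import Data.Rational using (ℚ; _*_; _-_; ½; 0ℚ; 1ℚ)
open import Data.Rational using () renaming (_≤_ to _≤ℚ_; _<_ to _<ℚ_)
open import Data.Product using (Σ; _×_; _,_)
open import Relation.Binary.PropositionalEquality using (_≡_)

module Removal
  (k d : ℕ) (1≤k : 1 ≤ k) (c₁ c₂ : ℚ) (0≤c₁ : 0ℚ ≤ℚ c₁) (c₁≤1 : c₁ ≤ℚ 1ℚ) (0≤c₂ : 0ℚ ≤ℚ c₂) (c₂≤1 : c₂ ≤ℚ 1ℚ)
  (n : ℕ) (G : Graph n) (k<n : k < n) (deg≤d : ∀ v → deg G v ≤ d)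
  (expands-at-k : iAtLeast G (λ s → s ≡ k) (c₁ * fromℕ d))
  where

  open import Data.Nat as ℕ using (NonZero)
  import Data.Nat.Properties as ℕ
  open import Data.Rational as ℚ using (_+_)
  import Data.Rational.Properties as ℚ
  open import Data.Fin.Subset using (Subset; ∣_∣; ∁; ⊥; _∪_)
  open import Data.Fin.Subset.Properties using (∣⊥∣≡0; ∣∁p∣≡n∸∣p∣)
  open import Data.Product using (proj₁; proj₂)
  open import Data.Empty using (⊥-elim) renaming (⊥ to Empty)
  open import Relation.Nullary using (Dec; yes; no)
  open import Relation.Nullary.Decidable using (_×-dec_)
  open import Relation.Binary.PropositionalEquality using (sym; trans; cong; subst)

  K D r c₃ : ℚ
  K = fromℕ k
  D = fromℕ d
  r = c₁ * c₂ * D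
  c₃ = c₁ * (1ℚ - c₂) * ½

  Sparse : Subset n → Set
  Sparse V = fromℕ (boundary G V) ≤ℚ r * fromℕ ∣ V ∣

  Small : Subset n → Set
  Small V = fromℕ ∣ V ∣ + c₃ * K <ℚ K

  Removable : Subset n → Set
  Removable V = Sparse V × Small V

  removable? : ∀ V → Dec (Removable V)
  removable? V = (fromℕ (boundary G V) ℚ.≤? r * fromℕ ∣ V ∣) ×-dec (fromℕ ∣ V ∣ + c₃ * K ℚ.<? K)

  0≤c₃K : 0ℚ ≤ℚ c₃ * K
  0≤c₃K = *-nonNeg (*-nonNeg (*-nonNeg 0≤c₁ (p≤q⇒0≤q-p c₂≤1)) (ℚ.nonNegative⁻¹ ½)) (fromℕ-nonNeg k)

  ∅-removable : Removable ⊥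
  ∅-removable = ℚ.≤-reflexive ∂∅≡r*∣∅∣ , subst (λ z → fromℕ z + c₃ * K <ℚ K) (sym (∣⊥∣≡0 n)) c₃K<K′
    where
    ∂∅≡0 : boundary G ⊥ ≡ 0
    ∂∅≡0 = ℕ.n≤0⇒n≡0 (subst (λ z → boundary G ⊥ ≤ z ℕ.* d) (∣⊥∣≡0 n) (boundary≤∣∣*Δ G deg≤d ⊥))
    ∂∅≡r*∣∅∣ : fromℕ (boundary G ⊥) ≡ r * fromℕ ∣ ⊥ {n} ∣
    ∂∅≡r*∣∅∣ = trans (cong fromℕ ∂∅≡0) (sym (trans (cong (λ z → r * fromℕ z) (∣⊥∣≡0 n)) (ℚ.*-zeroʳ r)))
    c₃K<K′ : fromℕ 0 + c₃ * K <ℚ K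
    c₃K<K′ = subst (_<ℚ K) (sym (ℚ.+-identityˡ (c₃ * K))) (c₃K<K c₁ c₂ K 0≤c₁ c₁≤1 0≤c₂ (fromℕ-mono-< 1≤k))

  largest : Σ (Subset n) λ U → Removable U × (∀ V → Removable V → ∣ V ∣ ≤ ∣ U ∣)
  largest = largestSubset removable? ∅-removable

  U : Subset n
  U = proj₁ largest

  U-sparse : Sparse U
  U-sparse = proj₁ (proj₁ (proj₂ largest))

  U-small : Small U
  U-small = proj₂ (proj₁ (proj₂ largest))

  U-largest : ∀ V → Removable V → ∣ V ∣ ≤ ∣ U ∣
  U-largest = proj₂ (proj₂ largest)

  q≤q+c₃K : ∀ q → q ≤ℚ q + c₃ * K
  q≤q+c₃K q = subst (_≤ℚ q + c₃ * K) (ℚ.+-identityʳ q) (ℚ.+-monoʳ-≤ q 0≤c₃K)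

  ∣U∣<k : ∣ U ∣ < k
  ∣U∣<k = fromℕ-cancel-< (ℚ.≤-<-trans (q≤q+c₃K (fromℕ ∣ U ∣)) U-small)

  G′ : Graph ∣ ∁ U ∣
  G′ = induced G (∁ U)

  no-sparse-set-near-k : ∀ X → ∣ X ∣ ≤ k → fromℕ (boundary G X) <ℚ r * fromℕ ∣ X ∣ →
                         K ≤ℚ fromℕ ∣ X ∣ + c₃ * K → Empty
  no-sparse-set-near-k X ∣X∣≤k X-sparse X-large =
    padding-inequalities-inconsistent c₁ c₂ D (fromℕ ∣ X ∣) Y (fromℕ (boundary G X))
      0≤c₁ 0≤c₂ (fromℕ-nonNeg d) (fromℕ-nonNeg y) X-sparse c₁DK≤∂X+YD
      (subst (λ z → z ≤ℚ fromℕ ∣ X ∣ + c₃ * z) K≡X+Y X-large)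
    where
    y : ℕ
    y = k ∸ ∣ X ∣
    Y : ℚ
    Y = fromℕ y
    padded : Σ (Subset n) λ W → ∣ W ∣ ≡ k × boundary G W ≤ boundary G X ℕ.+ y ℕ.* d
    padded = pad G deg≤d X ∣X∣≤k (ℕ.<⇒≤ k<n)
    W : Subset n
    W = proj₁ padded
    ∣W∣≡k : ∣ W ∣ ≡ k
    ∣W∣≡k = proj₁ (proj₂ padded)
    K≡X+Y : K ≡ fromℕ ∣ X ∣ + Y
    K≡X+Y = trans (cong fromℕ (sym (ℕ.m+[n∸m]≡n ∣X∣≤k))) (fromℕ-+ ∣ X ∣ y)
    instance
      W≢∅ : NonZero ∣ W ∣
      W≢∅ = ℕ.>-nonZero (subst (1 ≤_) (sym ∣W∣≡k) 1≤k)
    c₁DK≤∂W : c₁ * D * K ≤ℚ fromℕ (boundary G W)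
    c₁DK≤∂W = subst (λ z → c₁ * D * fromℕ z ≤ℚ fromℕ (boundary G W)) ∣W∣≡k
                (p≤m/n⇒p*n≤m (boundary G W) ∣ W ∣ (expands-at-k W ∣W∣≡k))
    c₁DK≤∂X+YD : c₁ * D * (fromℕ ∣ X ∣ + Y) ≤ℚ fromℕ (boundary G X) + Y * D
    c₁DK≤∂X+YD = begin
      c₁ * D * (fromℕ ∣ X ∣ + Y)          ≡⟨ cong (c₁ * D *_) K≡X+Y ⟨
      c₁ * D * K                          ≤⟨ c₁DK≤∂W ⟩
      fromℕ (boundary G W)                ≤⟨ fromℕ-mono-≤ (proj₂ (proj₂ padded)) ⟩
      fromℕ (boundary G X ℕ.+ y ℕ.* d)    ≡⟨ fromℕ-+ (boundary G X) (y ℕ.* d) ⟩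
      fromℕ (boundary G X) + fromℕ (y ℕ.* d) ≡⟨ cong (λ z → fromℕ (boundary G X) + z) (fromℕ-* y d) ⟩
      fromℕ (boundary G X) + Y * D        ∎
      where open ℚ.≤-Reasoning

  no-small-sparse-set-in-G′ : ∀ (s : Subset ∣ ∁ U ∣) → 1 ≤ ∣ s ∣ → fromℕ ∣ s ∣ ≤ℚ c₃ * K →
                              fromℕ (boundary G′ s) <ℚ r * fromℕ ∣ s ∣ → Empty
  no-small-sparse-set-in-G′ s 1≤∣s∣ s-small s-sparse = by-size (fromℕ ∣ X ∣ + c₃ * K ℚ.<? K)
    where
    X : Subset n
    X = U ∪ image (∁ U) s
    ∣X∣≡ : fromℕ ∣ X ∣ ≡ fromℕ ∣ U ∣ + fromℕ ∣ s ∣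
    ∣X∣≡ = trans (cong fromℕ (∣∪-image-∁∣ U s)) (fromℕ-+ ∣ U ∣ ∣ s ∣)
    X-sparse : fromℕ (boundary G X) <ℚ r * fromℕ ∣ X ∣
    X-sparse = begin-strict
      fromℕ (boundary G X)                              ≤⟨ fromℕ-mono-≤ (boundary-∪-image-∁ G U s) ⟩
      fromℕ (boundary G U ℕ.+ boundary G′ s)            ≡⟨ fromℕ-+ (boundary G U) (boundary G′ s) ⟩
      fromℕ (boundary G U) + fromℕ (boundary G′ s)      <⟨ ℚ.+-mono-≤-< U-sparse s-sparse ⟩
      r * fromℕ ∣ U ∣ + r * fromℕ ∣ s ∣                 ≡⟨ ℚ.*-distribˡ-+ r (fromℕ ∣ U ∣) (fromℕ ∣ s ∣) ⟨
      r * (fromℕ ∣ U ∣ + fromℕ ∣ s ∣)                   ≡⟨ cong (r *_) ∣X∣≡ ⟨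
      r * fromℕ ∣ X ∣                                   ∎
      where open ℚ.≤-Reasoning
    ∣U∣<∣X∣ : ∣ U ∣ < ∣ X ∣
    ∣U∣<∣X∣ = subst (∣ U ∣ <_) (sym (∣∪-image-∁∣ U s)) (ℕ.m<m+n ∣ U ∣ 1≤∣s∣)
    ∣X∣<k : ∣ X ∣ < k
    ∣X∣<k = fromℕ-cancel-< (begin-strict
      fromℕ ∣ X ∣                 ≡⟨ ∣X∣≡ ⟩
      fromℕ ∣ U ∣ + fromℕ ∣ s ∣   ≤⟨ ℚ.+-monoʳ-≤ (fromℕ ∣ U ∣) s-small ⟩
      fromℕ ∣ U ∣ + c₃ * K        <⟨ U-small ⟩
      K                           ∎)
      where open ℚ.≤-Reasoning
    by-size : Dec (Small X) → Empty
    by-size (yes X-small) = ℕ.<⇒≱ ∣U∣<∣X∣ (U-largest X (ℚ.<⇒≤ X-sparse , X-small))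
    by-size (no  X-large) = no-sparse-set-near-k X (ℕ.<⇒≤ ∣X∣<k) X-sparse (ℚ.≮⇒≥ X-large)

  G′-expands : iAtLeast G′ (λ s → (1 ≤ s) × (fromℕ s ≤ℚ c₃ * K)) r
  G′-expands s (1≤∣s∣ , s-small) = by-decision (r ℚ.≤? ratio G′ s)
    where
    by-decision : Dec (r ≤ℚ ratio G′ s) → r ≤ℚ ratio G′ s
    by-decision (yes r≤ratio) = r≤ratio
    by-decision (no  r≰ratio) = ⊥-elim (no-small-sparse-set-in-G′ s 1≤∣s∣ s-small
                                         (m/n<p⇒m<p*n (boundary G′ s) ∣ s ∣ (ℚ.≰⇒> r≰ratio)))

  n∸k≤∣G′∣ : n ∸ k ≤ ∣ ∁ U ∣
  n∸k≤∣G′∣ = subst (n ∸ k ≤_) (sym (∣∁p∣≡n∸∣p∣ U)) (ℕ.∸-monoʳ-≤ n (ℕ.<⇒≤ ∣U∣<k))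

open import Data.Integer using (+_)
open import Data.Rational using (_/_)

lemma3p2 : (k d : ℕ) → 1 ≤ k → 1 ≤ d →
    (c₁ c₂ : ℚ) → 0ℚ ≤ℚ c₁ → c₁ ≤ℚ 1ℚ → 0ℚ ≤ℚ c₂ → c₂ ≤ℚ 1ℚ →
    c₁ * (+ d / 1) <ℚ (+ k / 1) →
    (n : ℕ) (G : Graph n) → k < n → MaxDegree G d →
    iAtLeast G (λ s → s ≡ k) (c₁ * (+ d / 1)) →
    Σ ℕ λ m → Σ (Graph m) λ G' →
      IsSubgraph G' G × (n ∸ k ≤ m) ×
      iAtLeast G' (λ s → (1 ≤ s) × ((+ s / 1) ≤ℚ ((c₁ * (1ℚ - c₂) * ½) * (+ k / 1))))
        (c₁ * c₂ * (+ d / 1))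
lemma3p2 k d 1≤k _ c₁ c₂ 0≤c₁ c₁≤1 0≤c₂ c₂≤1 _ n G k<n (deg≤d , _) expands-at-k =
  ∣ ∁ U ∣ , G′ , (embed (∁ U) , (λ _ _ → embed-injective (∁ U)) , (λ _ _ e → e)) , n∸k≤∣G′∣ , G′-expands
  where
  open import Data.Fin.Subset using (∣_∣; ∁)
  open Removal k d 1≤k c₁ c₂ 0≤c₁ c₁≤1 0≤c₂ c₂≤1 n G k<n deg≤d expands-at-k
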